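{- Let $(A,R)$ be an associative Rota–Baxter algebra of weight $1$ over a field of characteristic zero, let $n\ge1$ and $a_1,\dots,a_n\in A$. Then $$\sum_{\sigma\in S_n}R\Big(R\big(\cdots R\big(R(a_{\sigma(1)})a_{\sigma(2)}\big)\cdots\big)a_{\sigma(n)}\Big)=\sum_{\sigma\in S_n}R\big(a_{\sigma(1)}\diamond_1a_{\sigma(2)}\diamond_2\cdots\diamond_{n-1}a_{\sigma(n)}\big),$$ where for $1\le i\le n-1$ the symbol $\diamond_i$ is $\ast_R$ if $\max\{\sigma(j):j\le i\}<\sigma(i+1)$ and is $\bullet_R$ otherwise; the expression on the right is evaluated by first performing all $\bullet_R$ products, each maximal run of consecutive $\bullet_R$ products being bracketed from left to right, i.e. $(\cdots((b_1\bullet_R b_2)\bullet_R b_3)\cdots)\bullet_R b_m$, and then taking the $\ast_R$ product of the resulting blocks (which is associative).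
   Context: A Rota–Baxter algebra of weight $1$ is an algebra $A$ with a linear map $R$ satisfying $R(a)R(b)=R(R(a)b+aR(b))+R(ab)$ for all $a,b$. Here $a\ast_R b:=R(a)b+aR(b)+ab$ (the double product, associative when $A$ is) and $a\bullet_R b:=R(a)b-bR(a)-ba$. The left-hand side for $n=1$ is $R(a_1)$. -}

module Defs where

open import Level using (Level; _⊔_) renaming (suc to lsuc)
open import Data.Nat using (ℕ; zero; suc; _<ᵇ_) renaming (_⊔_ to _⊔ℕ_)
open import Data.Fin using (Fin; zero; suc; toℕ; punchIn)
open import Data.List using (List; []; _∷_; map; foldr; foldl; concatMap; allFin)
open import Data.Bool using (if_then_else_)
open import Data.Maybe using (Maybe; just; nothing)
open import Data.Product using (Σ; _×_; _,_)
open import Relation.Binary.PropositionalEquality using (_≡_)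
open import Relation.Nullary using (¬_)
open import Algebra.Bundles using (CommutativeRing)
open import Algebra.Module.Bundles using (Module)
import Algebra.Definitions.RawMonoid as RawMonoidDefs

record IsFieldCharZero {c ℓ : Level} (K : CommutativeRing c ℓ) : Set (c ⊔ ℓ) where
  open CommutativeRing K using (Carrier; _≈_; 0#; 1#; _*_; +-rawMonoid)
  open RawMonoidDefs +-rawMonoid using () renaming (_×_ to _·ℕ_)
  field
    0≉1      : ¬ (0# ≈ 1#)
    inverse  : ∀ x → ¬ (x ≈ 0#) → Σ Carrier (λ y → x * y ≈ 1#)
    charZero : ∀ (n : ℕ) → n ·ℕ 1# ≈ 0# → n ≡ zero

record RBAlgebra {c ℓ : Level} (K : CommutativeRing c ℓ) (m ℓm : Level)
       : Set (c ⊔ ℓ ⊔ lsuc (m ⊔ ℓm)) where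
  open CommutativeRing K using () renaming (Carrier to Kc)
  field
    vectorSpace : Module K m ℓm
  open Module vectorSpace public using (Carrierᴹ; _≈ᴹ_; _+ᴹ_; _*ₗ_; 0ᴹ; -ᴹ_)
  infixl 7 _·_
  field
    _·_       : Carrierᴹ → Carrierᴹ → Carrierᴹ
    ·-cong    : ∀ {a a′ b b′} → a ≈ᴹ a′ → b ≈ᴹ b′ → a · b ≈ᴹ a′ · b′
    ·-assoc   : ∀ a b c → (a · b) · c ≈ᴹ a · (b · c)
    ·-distribˡ : ∀ a b c → a · (b +ᴹ c) ≈ᴹ (a · b) +ᴹ (a · c)
    ·-distribʳ : ∀ a b c → (b +ᴹ c) · a ≈ᴹ (b · a) +ᴹ (c · a)
    ·-*ₗˡ     : ∀ (k : Kc) a b → (k *ₗ a) · b ≈ᴹ k *ₗ (a · b)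
    ·-*ₗʳ     : ∀ (k : Kc) a b → a · (k *ₗ b) ≈ᴹ k *ₗ (a · b)
    R         : Carrierᴹ → Carrierᴹ
    R-cong    : ∀ {a b} → a ≈ᴹ b → R a ≈ᴹ R b
    R-+       : ∀ a b → R (a +ᴹ b) ≈ᴹ R a +ᴹ R b
    R-*ₗ      : ∀ (k : Kc) a → R (k *ₗ a) ≈ᴹ k *ₗ R a
    R-RB      : ∀ a b → R a · R b ≈ᴹ R ((R a · b) +ᴹ (a · R b)) +ᴹ R (a · b)

  _∗R_ : Carrierᴹ → Carrierᴹ → Carrierᴹ
  a ∗R b = ((R a · b) +ᴹ (a · R b)) +ᴹ (a · b)

  _•R_ : Carrierᴹ → Carrierᴹ → Carrierᴹ
  a •R b = ((R a · b) +ᴹ (-ᴹ (b · R a))) +ᴹ (-ᴹ (b · a))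

  sumᴹ : List Carrierᴹ → Carrierᴹ
  sumᴹ = foldr _+ᴹ_ 0ᴹ

-- Enumeration of the symmetric group S_n as a list of functions
-- Fin n → Fin n, each permutation occurring exactly once:
-- σ ↦ (σ 0 , punchOut-ed rest) is the bijection S_{n+1} ≅ Fin (n+1) × S_n.

permutations : (n : ℕ) → List (Fin n → Fin n)
permutations zero    = (λ ()) ∷ []
permutations (suc n) =
  concatMap (λ i → map (λ τ → extend i τ) (permutations n)) (allFin (suc n))
  where
  extend : Fin (suc n) → (Fin n → Fin n) → Fin (suc n) → Fin (suc n)
  extend i τ zero    = i
  extend i τ (suc j) = punchIn i (τ j)

data Op : Set where
  star bullet : Op

module Sides {c ℓ m ℓm : Level} {K : CommutativeRing c ℓ} (A : RBAlgebra K m ℓm) where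
  open RBAlgebra A using (Carrierᴹ; _·_; R; _∗R_; _•R_; sumᴹ)

  lhsTerm : Carrierᴹ → List Carrierᴹ → Carrierᴹ
  lhsTerm b₀ bs = foldl (λ acc b → R (acc · b)) (R b₀) bs

  -- the operation symbols: walking through σ(1),σ(2),… with the running
  -- maximum mx = max{σ(j) : j ≤ i}; ◇_i is ∗ iff mx < σ(i+1)
  opsWord : ∀ {n} → (Fin n → Carrierᴹ) → ℕ → List (Fin n) → List (Op × Carrierᴹ)
  opsWord a mx []       = []
  opsWord a mx (v ∷ vs) =
    ((if mx <ᵇ toℕ v then star else bullet) , a v) ∷ opsWord a (mx ⊔ℕ toℕ v) vs

  -- evaluation: maximal runs of •_R are bracketed left to right, and
  -- the resulting blocks are multiplied with ∗_R (left-bracketed; ∗_R is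
  -- associative).  acc = ∗-product of completed blocks, cur = current block.
  close : Maybe Carrierᴹ → Carrierᴹ → Carrierᴹ
  close nothing  cur = cur
  close (just p) cur = p ∗R cur

  evalWord : Maybe Carrierᴹ → Carrierᴹ → List (Op × Carrierᴹ) → Carrierᴹ
  evalWord acc cur []                  = close acc cur
  evalWord acc cur ((bullet , x) ∷ r) = evalWord acc (cur •R x) r
  evalWord acc cur ((star   , x) ∷ r) = evalWord (just (close acc cur)) x r

  -- for n = suc k, a : Fin (suc k) → A
  LHS : ∀ k → (Fin (suc k) → Carrierᴹ) → Carrierᴹ
  LHS k a = sumᴹ (map (λ σ → lhsTerm (a (σ zero)) (map (λ j → a (σ (suc j))) (allFin k)))
                      (permutations (suc k)))

  RHS : ∀ k → (Fin (suc k) → Carrierᴹ) → Carrierᴹ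
  RHS k a = sumᴹ (map (λ σ → R (evalWord nothing (a (σ zero))
                                  (opsWord a (toℕ (σ zero)) (map (λ j → σ (suc j)) (allFin k)))))
                      (permutations (suc k)))

{-# OPTIONS --safe #-}
module Submission where

-- Let L(w) = R(⋯R(R(a_{w₁}) a_{w₂})⋯ a_{w_k}) be the left-hand word of a word w of letters and
-- b_z(t) = (⋯(a_z • a_{t₁}) • ⋯) • a_{t_j}.  For a set S of letters write L_S y for the sum of L(s) y
-- over the orderings s of S (just y if S = ∅), and B_z(T) for the sum of b_z(t) over the orderings
-- t of T.  For any letters z and U, induction on |U| using R(x) R(y) = R(x ∗ y) and
-- p • c = R(p) c − c (R(p) + p) gives
--
--   Σ_{orderings w of {z} ∪ U} L(w)  =  Σ_{U = S ⊔ T} L_S R(B_z(T)).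
--
-- If z is the largest letter, then in a right-hand word s z t the product before z is ∗ and all
-- later ones are •, so the word evaluates to (right-hand word of s) R(b_z(t)).  Sorting the
-- orderings of {z} ∪ U by the position of z decomposes the right-hand side in the same way, and the
-- two sides agree by induction on the number of letters, applied to each S.

open import Level using (Level)
open import Data.Bool using (true; false)
open import Data.Bool.Properties using (T-≡; ¬-not)
open import Data.Fin as Fin using (Fin; toℕ; punchIn) renaming (zero to fzero; suc to fsuc)
open import Data.List using (List; []; _∷_; _++_; _∷ʳ_; map; foldr; foldl; concatMap; tabulate; allFin)
import Data.List.Properties as List
open import Data.List.Relation.Unary.All as All using (All)
import Data.List.Relation.Unary.All.Properties as All
open import Data.Maybe using (just; nothing)
open import Data.Nat as ℕ using (ℕ; zero; suc; pred; _≤_; z≤n; s≤s; _<ᵇ_)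
open import Data.Nat.Induction using (<-rec)
open import Data.Nat.Properties
  using (m≤n⇒m≤1+n; <⇒≤; ≤⇒≯; <⇒<ᵇ; <ᵇ⇒<; m≥n⇒m⊔n≡m; m≤n⇒m⊔n≡n; ⊔-lub)
open import Data.Product using (_×_; _,_; map₁; map₂)
open import Data.Vec as Vec using (Vec; []; _∷_)
import Data.Vec.Relation.Unary.All as VecAll
import Data.Vec.Relation.Unary.All.Properties as VecAll
open import Data.Vec.Relation.Unary.AllPairs as AllPairs using (AllPairs)
open import Function using (_∘_; id)
open import Function.Bundles using (Equivalence)
open import Relation.Binary.Core using (Rel)
open import Relation.Binary.PropositionalEquality as ≡ using (_≡_)
open import Algebra.Bundles using (CommutativeMonoid; CommutativeRing; AbelianGroup)
open import Algebra.Module.Bundles using (Module)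
open import Algebra.Morphism.Structures using (module MonoidMorphisms)
open import Defs using (IsFieldCharZero; permutations; RBAlgebra; module Sides; Op; star; bullet)

<ᵇ-true : ∀ {m n} → m ℕ.< n → (m <ᵇ n) ≡ true
<ᵇ-true m<n = Equivalence.to T-≡ (<⇒<ᵇ m<n)

<ᵇ-false : ∀ {m n} → n ≤ m → (m <ᵇ n) ≡ false
<ᵇ-false {m} {n} n≤m = ¬-not (λ m<ᵇn → ≤⇒≯ n≤m (<ᵇ⇒< m n (Equivalence.from T-≡ m<ᵇn)))

module _ {x} {X : Set x} where

  All-∷ʳ⁻ : ∀ {p} {P : X → Set p} {n} (U : Vec X n) z →
            VecAll.All P (U Vec.∷ʳ z) → VecAll.All P U × P z
  All-∷ʳ⁻ []      z (pz VecAll.∷ VecAll.[]) = VecAll.[] , pz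
  All-∷ʳ⁻ (u ∷ U) z (pu VecAll.∷ pUz)       = map₁ (pu VecAll.∷_) (All-∷ʳ⁻ U z pUz)

  AllPairs-∷ʳ⁻ : ∀ {r} {R : Rel X r} {n} (U : Vec X n) z → AllPairs R (U Vec.∷ʳ z) →
                 VecAll.All (λ u → R u z) U × AllPairs R U
  AllPairs-∷ʳ⁻ []      z _                      = VecAll.[] , AllPairs.[]
  AllPairs-∷ʳ⁻ (u ∷ U) z (Ru AllPairs.∷ sorted) =
    let RuU , Ruz     = All-∷ʳ⁻ U z Ru
        RUz , sortedU = AllPairs-∷ʳ⁻ U z sorted
    in  Ruz VecAll.∷ RUz , RuU AllPairs.∷ sortedU

  AllPairs-tabulate : ∀ {r} {R : Rel X r} {n} {f : Fin n → X} →
                      (∀ {i j} → i Fin.< j → R (f i) (f j)) → AllPairs R (Vec.tabulate f)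
  AllPairs-tabulate {n = zero}  f-mono = AllPairs.[]
  AllPairs-tabulate {n = suc n} f-mono =
    VecAll.tabulate⁺ (λ j → f-mono (s≤s z≤n)) AllPairs.∷ AllPairs-tabulate (λ i<j → f-mono (s≤s i<j))

module FiniteSums {c ℓ} (M : CommutativeMonoid c ℓ) where
  open CommutativeMonoid M renaming (Carrier to C)
  open MonoidMorphisms rawMonoid rawMonoid public using (IsMonoidHomomorphism)
  open import Algebra.Properties.CommutativeSemigroup commutativeSemigroup using (interchange)

  ∑ : ∀ {b} {B : Set b} → List B → (B → C) → C
  ∑ xs f = foldr _∙_ ε (map f xs)

  module _ {b} {B : Set b} where

    ∑-cong : ∀ (xs : List B) {f g : B → C} → (∀ x → f x ≈ g x) → ∑ xs f ≈ ∑ xs g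
    ∑-cong []       f≈g = refl
    ∑-cong (x ∷ xs) f≈g = ∙-cong (f≈g x) (∑-cong xs f≈g)

    ∑-cong-All : ∀ {p} {P : B → Set p} {xs : List B} {f g : B → C} →
                 All P xs → (∀ {x} → P x → f x ≈ g x) → ∑ xs f ≈ ∑ xs g
    ∑-cong-All All.[]         f≈g = refl
    ∑-cong-All (px All.∷ pxs) f≈g = ∙-cong (f≈g px) (∑-cong-All pxs f≈g)

    ∑-ε : ∀ (xs : List B) {f : B → C} → (∀ x → f x ≈ ε) → ∑ xs f ≈ ε
    ∑-ε []       f≈ε = refl
    ∑-ε (x ∷ xs) f≈ε = trans (∙-cong (f≈ε x) (∑-ε xs f≈ε)) (identityˡ ε)

    ∑-++ : ∀ (xs ys : List B) (f : B → C) → ∑ (xs ++ ys) f ≈ ∑ xs f ∙ ∑ ys f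
    ∑-++ []       ys f = sym (identityˡ _)
    ∑-++ (x ∷ xs) ys f = trans (∙-congˡ (∑-++ xs ys f)) (sym (assoc _ _ _))

    ∑-distrib-∙ : ∀ (xs : List B) (f g : B → C) → ∑ xs (λ x → f x ∙ g x) ≈ ∑ xs f ∙ ∑ xs g
    ∑-distrib-∙ []       f g = sym (identityˡ ε)
    ∑-distrib-∙ (x ∷ xs) f g = trans (∙-congˡ (∑-distrib-∙ xs f g)) (interchange _ _ _ _)

    ∑-homo : ∀ {φ : C → C} → IsMonoidHomomorphism φ →
             ∀ (xs : List B) (f : B → C) → φ (∑ xs f) ≈ ∑ xs (φ ∘ f)
    ∑-homo φ-homo []       f = IsMonoidHomomorphism.ε-homo φ-homo
    ∑-homo φ-homo (x ∷ xs) f =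
      trans (IsMonoidHomomorphism.homo φ-homo _ _) (∙-congˡ (∑-homo φ-homo xs f))

    ∑-map : ∀ {d} {D : Set d} (g : D → B) (xs : List D) (f : B → C) → ∑ (map g xs) f ≡ ∑ xs (f ∘ g)
    ∑-map g []       f = ≡.refl
    ∑-map g (x ∷ xs) f = ≡.cong (f (g x) ∙_) (∑-map g xs f)

    ∑-tabulate : ∀ {n} (g : Fin n → B) (f : B → C) → ∑ (tabulate g) f ≡ ∑ (allFin n) (f ∘ g)
    ∑-tabulate g f =
      ≡.trans (≡.cong (λ xs → ∑ xs f) (≡.sym (List.map-tabulate id g))) (∑-map g (allFin _) f)

    ∑-concatMap : ∀ {d} {D : Set d} (g : D → List B) (xs : List D) (f : B → C) →
                  ∑ (concatMap g xs) f ≈ ∑ xs (λ x → ∑ (g x) f)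
    ∑-concatMap g []       f = refl
    ∑-concatMap g (x ∷ xs) f = trans (∑-++ (g x) _ f) (∙-congˡ (∑-concatMap g xs f))

module Selections {x} (X : Set x) where

  picks : ∀ {n} → Vec X n → List (X × Vec X (pred n))
  picks []          = []
  picks (v ∷ [])    = (v , []) ∷ []
  picks (v ∷ w ∷ V) = (v , w ∷ V) ∷ map (map₂ (v ∷_)) (picks (w ∷ V))

  picks-All : ∀ {p} {P : X → Set p} {n} {V : Vec X n} → VecAll.All P V →
              All (λ (c , V′) → P c × VecAll.All P V′) (picks V)
  picks-All VecAll.[]                        = All.[]
  picks-All (pv VecAll.∷ VecAll.[])          = (pv , VecAll.[]) All.∷ All.[]
  picks-All (pv VecAll.∷ pws@(_ VecAll.∷ _)) =
    (pv , pws) All.∷ All.map⁺ (All.map (λ (pc , pV) → pc , pv VecAll.∷ pV) (picks-All pws))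

  infix 4 _∣_
  record Split : Set x where
    constructor _∣_
    field
      {i j} : ℕ
      left  : Vec X i
      right : Vec X j

  splits : ∀ {n} → Vec X n → List Split
  splits []      = ([] ∣ []) ∷ []
  splits (u ∷ U) = map (λ (S ∣ T) → u ∷ S ∣ T) (splits U)
                ++ map (λ (S ∣ T) → S ∣ u ∷ T) (splits U)

  splits-All : ∀ {p} {P : X → Set p} {n} {U : Vec X n} → VecAll.All P U →
               All (λ (S ∣ T) → VecAll.All P S × VecAll.All P T) (splits U)
  splits-All VecAll.[]        = (VecAll.[] , VecAll.[]) All.∷ All.[]
  splits-All (pu VecAll.∷ pU) =
    All.++⁺ (All.map⁺ (All.map (λ (pS , pT) → pu VecAll.∷ pS , pT) (splits-All pU)))
            (All.map⁺ (All.map (λ (pS , pT) → pS , pu VecAll.∷ pT) (splits-All pU)))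

  splits-AllPairs : ∀ {r} {R : Rel X r} {n} {U : Vec X n} → AllPairs R U →
                    All (λ (S ∣ _) → AllPairs R S) (splits U)
  splits-AllPairs AllPairs.[]            = AllPairs.[] All.∷ All.[]
  splits-AllPairs (Ru AllPairs.∷ sorted) =
    All.++⁺ (All.map⁺ (All.zipWith (λ (sortedS , RuS , _) → RuS AllPairs.∷ sortedS)
                                   (splits-AllPairs sorted , splits-All Ru)))
            (All.map⁺ (splits-AllPairs sorted))

  splits-length : ∀ {n} (U : Vec X n) → All (λ p → Split.i p ≤ n) (splits U)
  splits-length []      = z≤n All.∷ All.[]
  splits-length (u ∷ U) = All.++⁺ (All.map⁺ (All.map s≤s (splits-length U)))
                                  (All.map⁺ (All.map m≤n⇒m≤1+n (splits-length U)))

module SymmetricSums {c ℓ} (M : CommutativeMonoid c ℓ) {x} (X : Set x) where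
  open CommutativeMonoid M renaming (Carrier to C)
  open import Algebra.Properties.CommutativeSemigroup commutativeSemigroup using (x∙yz≈y∙xz)
  open import Relation.Binary.Reasoning.Setoid setoid
  open FiniteSums M
  open Selections X

  ∑-picks-∷ : ∀ {n} (F : ∀ {k} → X → Vec X k → C) (u : X) (U : Vec X n) →
              ∑ (picks (u ∷ U)) (λ (c , V) → F c V)
              ≈ F u U ∙ ∑ (picks U) (λ (c , U′) → F c (u ∷ U′))
  ∑-picks-∷ F u []      = refl
  ∑-picks-∷ F u (w ∷ U) = ∙-congˡ (reflexive (∑-map (map₂ (u ∷_)) (picks (w ∷ U)) _))

  ∑-picks-∷ʳ : ∀ {n} (F : ∀ {k} → X → Vec X k → C) (U : Vec X n) (z : X) →
               ∑ (picks (U Vec.∷ʳ z)) (λ (c , V) → F c V)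
               ≈ ∑ (picks U) (λ (c , U′) → F c (U′ Vec.∷ʳ z)) ∙ F z U
  ∑-picks-∷ʳ F []      z = comm _ _
  ∑-picks-∷ʳ F (u ∷ U) z = begin
    ∑ (picks (u ∷ (U Vec.∷ʳ z))) (λ (c , V) → F c V)
      ≈⟨ ∑-picks-∷ F u (U Vec.∷ʳ z) ⟩
    F u (U Vec.∷ʳ z) ∙ ∑ (picks (U Vec.∷ʳ z)) (λ (c , V) → F c (u ∷ V))
      ≈⟨ ∙-congˡ (∑-picks-∷ʳ (λ c V → F c (u ∷ V)) U z) ⟩
    F u (U Vec.∷ʳ z) ∙ (∑ (picks U) (λ (c , U′) → F c (u ∷ (U′ Vec.∷ʳ z))) ∙ F z (u ∷ U))
      ≈⟨ assoc _ _ _ ⟨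
    (F u (U Vec.∷ʳ z) ∙ ∑ (picks U) (λ (c , U′) → F c (u ∷ (U′ Vec.∷ʳ z)))) ∙ F z (u ∷ U)
      ≈⟨ ∙-congʳ (∑-picks-∷ (λ c V → F c (V Vec.∷ʳ z)) u U) ⟨
    ∑ (picks (u ∷ U)) (λ (c , U′) → F c (U′ Vec.∷ʳ z)) ∙ F z (u ∷ U) ∎

  ∑-picks-comm : ∀ {n} (G : ∀ {k} → X → X → Vec X k → C) (V : Vec X n) →
                 ∑ (picks V) (λ (c , V′) → ∑ (picks V′) (λ (d , V″) → G c d V″))
                 ≈ ∑ (picks V) (λ (c , V′) → ∑ (picks V′) (λ (d , V″) → G d c V″))
  ∑-picks-comm G []      = refl
  ∑-picks-comm G (v ∷ W) = begin
    _                                             ≈⟨ expand G ⟩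
    A G ∙ (A (λ c d → G d c) ∙ B G)
      ≈⟨ ∙-congˡ (∙-congˡ (∑-picks-comm (λ c d W″ → G c d (v ∷ W″)) W)) ⟩
    A G ∙ (A (λ c d → G d c) ∙ B (λ c d → G d c)) ≈⟨ x∙yz≈y∙xz _ _ _ ⟩
    A (λ c d → G d c) ∙ (A G ∙ B (λ c d → G d c)) ≈⟨ expand (λ c d → G d c) ⟨
    _                                             ∎
    where
    A B : (∀ {k} → X → X → Vec X k → C) → C
    A G = ∑ (picks W) (λ (d , W′) → G v d W′)
    B G = ∑ (picks W) (λ (c , W′) → ∑ (picks W′) (λ (d , W″) → G c d (v ∷ W″)))

    expand : ∀ (G : ∀ {k} → X → X → Vec X k → C) →
             ∑ (picks (v ∷ W)) (λ (c , V′) → ∑ (picks V′) (λ (d , V″) → G c d V″))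
             ≈ A G ∙ (A (λ c d → G d c) ∙ B G)
    expand G = begin
      _ ≈⟨ ∑-picks-∷ (λ c V′ → ∑ (picks V′) (λ (d , V″) → G c d V″)) v W ⟩
      A G ∙ ∑ (picks W) (λ (c , W′) → ∑ (picks (v ∷ W′)) (λ (d , V″) → G c d V″))
        ≈⟨ ∙-congˡ (∑-cong (picks W) (λ (c , W′) → ∑-picks-∷ (G c) v W′)) ⟩
      A G ∙ ∑ (picks W) (λ (c , W′) → G c v W′ ∙ ∑ (picks W′) (λ (d , W″) → G c d (v ∷ W″)))
        ≈⟨ ∙-congˡ (∑-distrib-∙ (picks W) _ _) ⟩
      A G ∙ (A (λ c d → G d c) ∙ B G) ∎

  -- Recursive calls give the length explicitly: the termination checker does not see that the
  -- remainders in picks V have length n when V has length suc n.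
  symSum : ∀ {n} → (List X → C) → Vec X n → C
  symSum {zero}  h _ = h []
  symSum {suc n} h V = ∑ (picks V) (λ (c , V′) → symSum {n} (h ∘ (c ∷_)) V′)

  symSum-cong : ∀ {n} {h h′ : List X → C} (V : Vec X n) → (∀ w → h w ≈ h′ w) →
                symSum h V ≈ symSum h′ V
  symSum-cong {zero}  V h≈h′ = h≈h′ []
  symSum-cong {suc n} V h≈h′ = ∑-cong (picks V) (λ (c , V′) → symSum-cong {n} V′ (h≈h′ ∘ (c ∷_)))

  symSum-cong-All : ∀ {p} {P : X → Set p} {n} {h h′ : List X → C} (V : Vec X n) → VecAll.All P V →
                    (∀ w → All P w → h w ≈ h′ w) → symSum h V ≈ symSum h′ V
  symSum-cong-All {n = zero}  V pV h≈h′ = h≈h′ [] All.[]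
  symSum-cong-All {n = suc n} V pV h≈h′ = ∑-cong-All (picks-All pV) λ {(c , V′)} (pc , pV′) →
    symSum-cong-All {n = n} V′ pV′ (λ w pw → h≈h′ (c ∷ w) (pc All.∷ pw))

  symSum-distrib-∙ : ∀ {n} (f g : List X → C) (V : Vec X n) →
                     symSum (λ w → f w ∙ g w) V ≈ symSum f V ∙ symSum g V
  symSum-distrib-∙ {zero}  f g V = refl
  symSum-distrib-∙ {suc n} f g V = begin
    ∑ (picks V) (λ (c , V′) → symSum (λ w → f (c ∷ w) ∙ g (c ∷ w)) V′)
      ≈⟨ ∑-cong (picks V) (λ (c , V′) → symSum-distrib-∙ {n} (f ∘ (c ∷_)) (g ∘ (c ∷_)) V′) ⟩
    ∑ (picks V) (λ (c , V′) → symSum (f ∘ (c ∷_)) V′ ∙ symSum (g ∘ (c ∷_)) V′)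
      ≈⟨ ∑-distrib-∙ (picks V) _ _ ⟩
    symSum f V ∙ symSum g V ∎

  symSum-homo : ∀ {φ : C → C} → IsMonoidHomomorphism φ →
                ∀ {n} (h : List X → C) (V : Vec X n) → φ (symSum h V) ≈ symSum (φ ∘ h) V
  symSum-homo φ-homo {zero}  h V = refl
  symSum-homo φ-homo {suc n} h V =
    trans (∑-homo φ-homo (picks V) _) (∑-cong (picks V) (λ (c , V′) → symSum-homo φ-homo {n} _ V′))

  ifEmpty : ∀ {n} → Vec X n → C → C
  ifEmpty []      z = z
  ifEmpty (_ ∷ _) z = ε

  symSum-unfold : ∀ {n} (h : List X → C) (V : Vec X n) →
                  symSum h V ≈ ifEmpty V (h []) ∙ ∑ (picks V) (λ (c , V′) → symSum (h ∘ (c ∷_)) V′)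
  symSum-unfold h []      = sym (identityʳ _)
  symSum-unfold h (_ ∷ _) = sym (identityˡ _)

  symSum-byLast : ∀ {n} (h : List X → C) (V : Vec X (suc n)) →
                  symSum h V ≈ ∑ (picks V) (λ (c , V′) → symSum (λ w → h (w ∷ʳ c)) V′)
  symSum-byLast {zero}  h (v ∷ []) = refl
  symSum-byLast {suc n} h V = begin
    symSum h V
      ≈⟨ ∑-cong (picks V) (λ (c , V′) → symSum-byLast {n} (h ∘ (c ∷_)) V′) ⟩
    ∑ (picks V) (λ (c , V′) → ∑ (picks V′) (λ (d , V″) → symSum (λ w → h (c ∷ w ∷ʳ d)) V″))
      ≈⟨ ∑-picks-comm (λ c d V″ → symSum (λ w → h (c ∷ w ∷ʳ d)) V″) V ⟩
    ∑ (picks V) (λ (c , V′) → symSum (λ w → h (w ∷ʳ c)) V′) ∎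

  symSum-∷ʳ : ∀ {n} (h : List X → C) (U : Vec X n) (z : X) → symSum h (U Vec.∷ʳ z) ≈ symSum h (z ∷ U)
  symSum-∷ʳ {zero}  h [] z = refl
  symSum-∷ʳ {suc n} h U  z = begin
    symSum h (U Vec.∷ʳ z)
      ≈⟨ ∑-picks-∷ʳ (λ c V → symSum (h ∘ (c ∷_)) V) U z ⟩
    ∑ (picks U) (λ (c , U′) → symSum (h ∘ (c ∷_)) (U′ Vec.∷ʳ z)) ∙ symSum (h ∘ (z ∷_)) U
      ≈⟨ ∙-congʳ (∑-cong (picks U) (λ (c , U′) → symSum-∷ʳ {n} (h ∘ (c ∷_)) U′ z)) ⟩
    ∑ (picks U) (λ (c , U′) → symSum (h ∘ (c ∷_)) (z ∷ U′)) ∙ symSum (h ∘ (z ∷_)) U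
      ≈⟨ comm _ _ ⟩
    symSum (h ∘ (z ∷_)) U ∙ ∑ (picks U) (λ (c , U′) → symSum (h ∘ (c ∷_)) (z ∷ U′))
      ≈⟨ ∑-picks-∷ (λ c V → symSum (h ∘ (c ∷_)) V) z U ⟨
    symSum h (z ∷ U) ∎

  ∑-splits-∷ : ∀ {n} (F : ∀ {i j} → Vec X i → Vec X j → C) (u : X) (U : Vec X n) →
               ∑ (splits (u ∷ U)) (λ (S ∣ T) → F S T)
               ≈ ∑ (splits U) (λ (S ∣ T) → F (u ∷ S) T) ∙ ∑ (splits U) (λ (S ∣ T) → F S (u ∷ T))
  ∑-splits-∷ F u U = trans (∑-++ (map _ (splits U)) _ _)
                           (∙-cong (reflexive (∑-map _ (splits U) _)) (reflexive (∑-map _ (splits U) _)))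

  ∑-splits-swap : ∀ {n} (F : ∀ {i j} → Vec X i → Vec X j → C) (U : Vec X n) →
                  ∑ (splits U) (λ (S ∣ T) → F S T) ≈ ∑ (splits U) (λ (S ∣ T) → F T S)
  ∑-splits-swap F []      = refl
  ∑-splits-swap F (u ∷ U) = begin
    _ ≈⟨ ∑-splits-∷ F u U ⟩
    ∑ (splits U) (λ (S ∣ T) → F (u ∷ S) T) ∙ ∑ (splits U) (λ (S ∣ T) → F S (u ∷ T))
      ≈⟨ ∙-cong (∑-splits-swap (λ S T → F (u ∷ S) T) U) (∑-splits-swap (λ S T → F S (u ∷ T)) U) ⟩
    ∑ (splits U) (λ (S ∣ T) → F (u ∷ T) S) ∙ ∑ (splits U) (λ (S ∣ T) → F T (u ∷ S))
      ≈⟨ comm _ _ ⟩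
    ∑ (splits U) (λ (S ∣ T) → F T (u ∷ S)) ∙ ∑ (splits U) (λ (S ∣ T) → F (u ∷ T) S)
      ≈⟨ ∑-splits-∷ (λ S T → F T S) u U ⟨
    _ ∎

  ∑-splits-[]ʳ : ∀ {n} (F : ∀ {i j} → Vec X i → Vec X j → C) →
                 (∀ {i j} (S : Vec X i) u (T : Vec X j) → F S (u ∷ T) ≈ ε) →
                 (U : Vec X n) → ∑ (splits U) (λ (S ∣ T) → F S T) ≈ F U []
  ∑-splits-[]ʳ F F≈ε []      = identityʳ _
  ∑-splits-[]ʳ F F≈ε (u ∷ U) = begin
    _ ≈⟨ ∑-splits-∷ F u U ⟩
    ∑ (splits U) (λ (S ∣ T) → F (u ∷ S) T) ∙ ∑ (splits U) (λ (S ∣ T) → F S (u ∷ T))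
      ≈⟨ ∙-cong (∑-splits-[]ʳ (λ S T → F (u ∷ S) T) (λ S → F≈ε (u ∷ S)) U)
                (∑-ε (splits U) (λ (S ∣ T) → F≈ε S u T)) ⟩
    F (u ∷ U) [] ∙ ε ≈⟨ identityʳ _ ⟩
    F (u ∷ U) []     ∎

  ∑-splits-[]ˡ : ∀ {n} (F : ∀ {i j} → Vec X i → Vec X j → C) →
                 (∀ {i j} (S : Vec X i) u (T : Vec X j) → F (u ∷ S) T ≈ ε) →
                 (U : Vec X n) → ∑ (splits U) (λ (S ∣ T) → F S T) ≈ F [] U
  ∑-splits-[]ˡ F F≈ε U =
    trans (∑-splits-swap F U) (∑-splits-[]ʳ (λ S T → F T S) (λ S u T → F≈ε T u S) U)

  ∑-splits-picksʳ : ∀ {n} (F : ∀ {i j} → Vec X i → X → Vec X j → C) (U : Vec X n) →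
                    ∑ (splits U) (λ (S ∣ T) → ∑ (picks T) (λ (c , T′) → F S c T′))
                    ≈ ∑ (picks U) (λ (c , U′) → ∑ (splits U′) (λ (S ∣ T) → F S c T))
  ∑-splits-picksʳ F []      = identityʳ _
  ∑-splits-picksʳ F (u ∷ U) = begin
    _ ≈⟨ ∑-splits-∷ (λ S T → ∑ (picks T) (λ (c , T′) → F S c T′)) u U ⟩
    ∑ (splits U) (λ (S ∣ T) → ∑ (picks T) (λ (c , T′) → F (u ∷ S) c T′))
      ∙ ∑ (splits U) (λ (S ∣ T) → ∑ (picks (u ∷ T)) (λ (c , T′) → F S c T′))
      ≈⟨ ∙-cong (∑-splits-picksʳ (λ S → F (u ∷ S)) U) (begin
           _ ≈⟨ ∑-cong (splits U) (λ (S ∣ T) → ∑-picks-∷ (F S) u T) ⟩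
           _ ≈⟨ ∑-distrib-∙ (splits U) _ _ ⟩
           _ ≈⟨ ∙-congˡ (∑-splits-picksʳ (λ S c T → F S c (u ∷ T)) U) ⟩
           P ∙ Q₂ ∎) ⟩
    Q₁ ∙ (P ∙ Q₂) ≈⟨ x∙yz≈y∙xz _ _ _ ⟩
    P ∙ (Q₁ ∙ Q₂)
      ≈⟨ ∙-congˡ (trans (∑-cong (picks U) (λ (c , U′) → ∑-splits-∷ (λ S T → F S c T) u U′))
                        (∑-distrib-∙ (picks U) _ _)) ⟨
    P ∙ ∑ (picks U) (λ (c , U′) → ∑ (splits (u ∷ U′)) (λ (S ∣ T) → F S c T))
      ≈⟨ ∑-picks-∷ (λ c V → ∑ (splits V) (λ (S ∣ T) → F S c T)) u U ⟨
    _ ∎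
    where
    P  = ∑ (splits U) (λ (S ∣ T) → F S u T)
    Q₁ = ∑ (picks U) (λ (c , U′) → ∑ (splits U′) (λ (S ∣ T) → F (u ∷ S) c T))
    Q₂ = ∑ (picks U) (λ (c , U′) → ∑ (splits U′) (λ (S ∣ T) → F S c (u ∷ T)))

  ∑-splits-picksˡ : ∀ {n} (F : ∀ {i j} → Vec X i → X → Vec X j → C) (U : Vec X n) →
                    ∑ (splits U) (λ (S ∣ T) → ∑ (picks S) (λ (c , S′) → F S′ c T))
                    ≈ ∑ (picks U) (λ (c , U′) → ∑ (splits U′) (λ (S ∣ T) → F S c T))
  ∑-splits-picksˡ F U = begin
    _ ≈⟨ ∑-splits-swap (λ S T → ∑ (picks S) (λ (c , S′) → F S′ c T)) U ⟩
    _ ≈⟨ ∑-splits-picksʳ (λ T c S → F S c T) U ⟩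
    _ ≈⟨ ∑-cong (picks U) (λ (c , U′) → ∑-splits-swap (λ T S → F S c T) U′) ⟩
    _ ∎

  symSum-insert : ∀ {n} (h : List X → C) (z : X) (U : Vec X n) →
                  symSum h (z ∷ U)
                  ≈ ∑ (splits U) (λ (S ∣ T) → symSum (λ s → symSum (λ t → h (s ++ z ∷ t)) T) S)
  symSum-insert {zero}  h z [] = refl
  symSum-insert {suc n} h z U  = begin
    symSum h (z ∷ U)
      ≈⟨ ∑-picks-∷ (λ c V → symSum (h ∘ (c ∷_)) V) z U ⟩
    symSum (h ∘ (z ∷_)) U ∙ ∑ (picks U) (λ (c , U′) → symSum (h ∘ (c ∷_)) (z ∷ U′))
      ≈⟨ ∙-cong (∑-splits-[]ˡ (λ S T → ifEmpty S (symSum (h ∘ (z ∷_)) T)) (λ _ _ _ → refl) U)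
                (trans (∑-splits-picksˡ (λ S c T → symSum (λ s → symSum (λ t → h (c ∷ s ++ z ∷ t)) T) S)
                                        U)
                       (sym (∑-cong (picks U) (λ (c , U′) → symSum-insert {n} (h ∘ (c ∷_)) z U′)))) ⟨
    ∑ (splits U) (λ (S ∣ T) → ifEmpty S (symSum (h ∘ (z ∷_)) T))
      ∙ ∑ (splits U) (λ (S ∣ T) →
          ∑ (picks S) (λ (c , S′) → symSum (λ s → symSum (λ t → h (c ∷ s ++ z ∷ t)) T) S′))
      ≈⟨ ∑-distrib-∙ (splits U) _ _ ⟨
    _ ≈⟨ ∑-cong (splits U) (λ (S ∣ T) → symSum-unfold (λ s → symSum (λ t → h (s ++ z ∷ t)) T) S) ⟨
    _ ∎

  ∑-picks-tabulate : ∀ {n} (f : Fin (suc n) → X) (F : X × Vec X n → C) →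
                     ∑ (picks (Vec.tabulate f)) F
                     ≈ ∑ (allFin (suc n)) (λ i → F (f i , Vec.tabulate (f ∘ punchIn i)))
  ∑-picks-tabulate {zero}  f F = refl
  ∑-picks-tabulate {suc n} f F = ∙-congˡ (begin
    ∑ (map (map₂ (f fzero ∷_)) (picks (Vec.tabulate (f ∘ fsuc)))) F
      ≡⟨ ∑-map (map₂ (f fzero ∷_)) (picks (Vec.tabulate (f ∘ fsuc))) F ⟩
    ∑ (picks (Vec.tabulate (f ∘ fsuc))) (F ∘ map₂ (f fzero ∷_))
      ≈⟨ ∑-picks-tabulate (f ∘ fsuc) (F ∘ map₂ (f fzero ∷_)) ⟩
    ∑ (allFin (suc n)) (λ i → F (f (fsuc i) , Vec.tabulate (f ∘ punchIn (fsuc i))))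
      ≡⟨ ∑-tabulate {n = suc n} fsuc (λ i → F (f i , Vec.tabulate (f ∘ punchIn i))) ⟨
    ∑ (tabulate fsuc) (λ i → F (f i , Vec.tabulate (f ∘ punchIn i))) ∎)

  ∑-permutations : ∀ {n} (f : Fin n → X) (h : List X → C) →
                   ∑ (permutations n) (λ σ → h (tabulate (f ∘ σ))) ≈ symSum h (Vec.tabulate f)
  ∑-permutations {zero}  f h = identityʳ _
  ∑-permutations {suc n} f h = ∑-extensions (λ i τ → ≡.refl)
    where
    -- permutations (suc n) extends each τ by a choice i of σ 0 through a where-bound function of Defs,
    -- which cannot be named here; it is abstracted as E and characterised by its effect on words.
    ∑-extensions : ∀ {E : Fin (suc n) → (Fin n → Fin n) → Fin (suc n) → Fin (suc n)} →
                   (∀ i τ → tabulate (f ∘ E i τ) ≡ f i ∷ tabulate (f ∘ punchIn i ∘ τ)) →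
                   ∑ (concatMap (λ i → map (E i) (permutations n)) (allFin (suc n)))
                     (λ σ → h (tabulate (f ∘ σ)))
                   ≈ symSum h (Vec.tabulate f)
    ∑-extensions {E} E-tabulate = begin
      _ ≈⟨ ∑-concatMap (λ i → map (E i) (permutations n)) (allFin (suc n)) _ ⟩
      ∑ (allFin (suc n)) (λ i → ∑ (map (E i) (permutations n)) (λ σ → h (tabulate (f ∘ σ))))
        ≈⟨ ∑-cong (allFin (suc n)) (λ i → trans (reflexive (∑-map (E i) (permutations n) _))
             (∑-cong (permutations n) (λ τ → reflexive (≡.cong h (E-tabulate i τ))))) ⟩
      ∑ (allFin (suc n)) (λ i → ∑ (permutations n) (λ τ → h (f i ∷ tabulate (f ∘ punchIn i ∘ τ))))
        ≈⟨ ∑-cong (allFin (suc n)) (λ i → ∑-permutations (f ∘ punchIn i) (h ∘ (f i ∷_))) ⟩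
      ∑ (allFin (suc n)) (λ i → symSum (h ∘ (f i ∷_)) (Vec.tabulate (f ∘ punchIn i)))
        ≈⟨ ∑-picks-tabulate f (λ (c , V) → symSum (h ∘ (c ∷_)) V) ⟨
      symSum h (Vec.tabulate f) ∎

module RotaBaxterWords {c ℓ m ℓm} {K : CommutativeRing c ℓ} (A : RBAlgebra K m ℓm) where
  open RBAlgebra A
  open Module vectorSpace
    using ( +ᴹ-commutativeMonoid; +ᴹ-abelianGroup; ≈ᴹ-setoid
          ; ≈ᴹ-refl; ≈ᴹ-sym; ≈ᴹ-trans; ≈ᴹ-reflexive
          ; +ᴹ-cong; +ᴹ-congˡ; +ᴹ-congʳ; +ᴹ-assoc; +ᴹ-identityˡ; +ᴹ-identityʳ
          ; -ᴹ‿cong; -ᴹ‿inverseˡ)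
  open AbelianGroup +ᴹ-abelianGroup using (group; commutativeSemigroup)
  open import Algebra.Properties.AbelianGroup +ᴹ-abelianGroup using (⁻¹-∙-comm)
  open import Algebra.Properties.Group group using (identityˡ-unique; inverseˡ-unique)
  open import Algebra.Properties.CommutativeSemigroup commutativeSemigroup using (interchange)
  open import Relation.Binary.Reasoning.Setoid ≈ᴹ-setoid
  open FiniteSums +ᴹ-commutativeMonoid
  open IsMonoidHomomorphism using (⟦⟧-cong; homo; ε-homo)
  open Sides A using (lhsTerm; opsWord; evalWord; close)

  additive : ∀ {φ : Carrierᴹ → Carrierᴹ} → (∀ {x y} → x ≈ᴹ y → φ x ≈ᴹ φ y) →
             (∀ x y → φ (x +ᴹ y) ≈ᴹ φ x +ᴹ φ y) → IsMonoidHomomorphism φ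
  additive {φ} φ-cong φ-+ = record
    { isMagmaHomomorphism = record { isRelHomomorphism = record { cong = φ-cong } ; homo = φ-+ }
    ; ε-homo = identityˡ-unique (φ 0ᴹ) (φ 0ᴹ)
                 (≈ᴹ-trans (≈ᴹ-sym (φ-+ 0ᴹ 0ᴹ)) (φ-cong (+ᴹ-identityʳ 0ᴹ)))
    }

  -ᴹ-homo : ∀ {φ} → IsMonoidHomomorphism φ → ∀ x → φ (-ᴹ x) ≈ᴹ -ᴹ φ x
  -ᴹ-homo {φ} φ-homo x = inverseˡ-unique (φ (-ᴹ x)) (φ x) (begin
    φ (-ᴹ x) +ᴹ φ x ≈⟨ homo φ-homo _ _ ⟨
    φ (-ᴹ x +ᴹ x)   ≈⟨ ⟦⟧-cong φ-homo (-ᴹ‿inverseˡ x) ⟩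
    φ 0ᴹ            ≈⟨ ε-homo φ-homo ⟩
    0ᴹ              ∎)

  ∑-difference : ∀ {b} {B : Set b} (xs : List B) (f g : B → Carrierᴹ) →
                ∑ xs (λ x → f x +ᴹ -ᴹ g x) ≈ᴹ ∑ xs f +ᴹ -ᴹ ∑ xs g
  ∑-difference xs f g =
    ≈ᴹ-trans (∑-distrib-∙ xs f _) (+ᴹ-congˡ (≈ᴹ-sym (∑-homo negation-homo xs g)))
    where negation-homo = additive -ᴹ‿cong (λ x y → ≈ᴹ-sym (⁻¹-∙-comm x y))

  R-homo : IsMonoidHomomorphism R
  R-homo = additive R-cong R-+

  ·-homoʳ : ∀ z → IsMonoidHomomorphism (_· z)
  ·-homoʳ z = additive (λ e → ·-cong e ≈ᴹ-refl) (λ x y → ·-distribʳ z x y)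

  ·-homoˡ : ∀ z → IsMonoidHomomorphism (z ·_)
  ·-homoˡ z = additive (·-cong ≈ᴹ-refl) (·-distribˡ z)

  R-∗R : ∀ p q → R (p ∗R q) ≈ᴹ R p · R q
  R-∗R p q = ≈ᴹ-trans (R-+ _ _) (≈ᴹ-sym (R-RB p q))

  •R-expand : ∀ p z → p •R z ≈ᴹ R p · z +ᴹ -ᴹ (z · (R p +ᴹ p))
  •R-expand p z = begin
    (R p · z +ᴹ -ᴹ (z · R p)) +ᴹ -ᴹ (z · p)   ≈⟨ +ᴹ-assoc _ _ _ ⟩
    R p · z +ᴹ (-ᴹ (z · R p) +ᴹ -ᴹ (z · p))   ≈⟨ +ᴹ-congˡ (⁻¹-∙-comm _ _) ⟩
    R p · z +ᴹ -ᴹ (z · R p +ᴹ z · p)          ≈⟨ +ᴹ-congˡ (-ᴹ‿cong (·-distribˡ z (R p) p)) ⟨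
    R p · z +ᴹ -ᴹ (z · (R p +ᴹ p))            ∎

  •R-homo : ∀ z → IsMonoidHomomorphism (_•R z)
  •R-homo z = additive
    (λ e → +ᴹ-cong (+ᴹ-cong (·-cong (R-cong e) ≈ᴹ-refl) (-ᴹ‿cong (·-cong ≈ᴹ-refl (R-cong e))))
                   (-ᴹ‿cong (·-cong ≈ᴹ-refl e)))
    (λ p q → begin
      (R (p +ᴹ q) · z +ᴹ -ᴹ (z · R (p +ᴹ q))) +ᴹ -ᴹ (z · (p +ᴹ q))
        ≈⟨ +ᴹ-cong (+ᴹ-cong (≈ᴹ-trans (·-cong (R-+ p q) ≈ᴹ-refl) (·-distribʳ z _ _))
                            (-ᴹ‿cong (≈ᴹ-trans (·-cong ≈ᴹ-refl (R-+ p q)) (·-distribˡ z _ _))))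
                   (-ᴹ‿cong (·-distribˡ z p q)) ⟩
      (R p · z +ᴹ R q · z +ᴹ -ᴹ (z · R p +ᴹ z · R q)) +ᴹ -ᴹ (z · p +ᴹ z · q)
        ≈⟨ +ᴹ-cong (+ᴹ-congˡ (≈ᴹ-sym (⁻¹-∙-comm _ _))) (≈ᴹ-sym (⁻¹-∙-comm _ _)) ⟩
      (R p · z +ᴹ R q · z +ᴹ (-ᴹ (z · R p) +ᴹ -ᴹ (z · R q))) +ᴹ (-ᴹ (z · p) +ᴹ -ᴹ (z · q))
        ≈⟨ +ᴹ-congʳ (interchange _ _ _ _) ⟩
      ((R p · z +ᴹ -ᴹ (z · R p)) +ᴹ (R q · z +ᴹ -ᴹ (z · R q))) +ᴹ (-ᴹ (z · p) +ᴹ -ᴹ (z · q))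
        ≈⟨ interchange _ _ _ _ ⟩
      p •R z +ᴹ q •R z ∎)

  module Words {x} {X : Set x} (a : X → Carrierᴹ) where
    open Selections X
    open SymmetricSums +ᴹ-commutativeMonoid X

    foldl-map-∷ʳ : ∀ {b} {B : Set b} (f : B → Carrierᴹ → B) e w y →
                   foldl f e (map a (w ∷ʳ y)) ≡ f (foldl f e (map a w)) (a y)
    foldl-map-∷ʳ f e w y =
      ≡.trans (≡.cong (foldl f e) (List.map-++ a w (y ∷ []))) (List.foldl-∷ʳ f e (a y) (map a w))

    mulWord : (List X → Carrierᴹ) → List X → Carrierᴹ → Carrierᴹ
    mulWord h []      z = z
    mulWord h (y ∷ w) z = h (y ∷ w) · z

    mulWord-homo : ∀ h s → IsMonoidHomomorphism (mulWord h s)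
    mulWord-homo h []      = additive id (λ _ _ → ≈ᴹ-refl)
    mulWord-homo h (y ∷ w) = ·-homoˡ (h (y ∷ w))

    mulWord-assoc : ∀ h s p q → mulWord h s p · q ≈ᴹ mulWord h s (p · q)
    mulWord-assoc h []      p q = ≈ᴹ-refl
    mulWord-assoc h (y ∷ w) p q = ·-assoc _ _ _

    symMul : ∀ {n} → (List X → Carrierᴹ) → Vec X n → Carrierᴹ → Carrierᴹ
    symMul h S z = symSum (λ s → mulWord h s z) S

    symMul-homo : ∀ {n} h (S : Vec X n) → IsMonoidHomomorphism (symMul h S)
    symMul-homo h S = additive
      (λ e → symSum-cong S (λ s → ⟦⟧-cong (mulWord-homo h s) e))
      (λ p q → ≈ᴹ-trans (symSum-cong S (λ s → homo (mulWord-homo h s) p q)) (symSum-distrib-∙ _ _ S))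

    symMul-assoc : ∀ {n} h (S : Vec X n) p q → symMul h S p · q ≈ᴹ symMul h S (p · q)
    symMul-assoc h S p q =
      ≈ᴹ-trans (symSum-homo (·-homoʳ q) _ S) (symSum-cong S (λ s → mulWord-assoc h s p q))

    symMul-∷ : ∀ {n} h (S : Vec X (suc n)) z → symMul h S z ≈ᴹ symSum h S · z
    symMul-∷ h S z = ≈ᴹ-sym (symSum-homo (·-homoʳ z) h S)

    symSum≈⇒symMul≈ : ∀ {n} {h h′ : List X → Carrierᴹ} (S : Vec X n) z →
                      symSum h S ≈ᴹ symSum h′ S → symMul h S z ≈ᴹ symMul h′ S z
    symSum≈⇒symMul≈               []         z _    = ≈ᴹ-refl
    symSum≈⇒symMul≈ {h = h} {h′} S@(_ ∷ _) z h≈h′ =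
      ≈ᴹ-trans (symMul-∷ h S z) (≈ᴹ-trans (·-cong h≈h′ ≈ᴹ-refl) (≈ᴹ-sym (symMul-∷ h′ S z)))

    lhsWord : List X → Carrierᴹ
    lhsWord []      = 0ᴹ
    lhsWord (y ∷ w) = lhsTerm (a y) (map a w)

    lhsWord-∷ʳ : ∀ w y → lhsWord (w ∷ʳ y) ≈ᴹ R (mulWord lhsWord w (a y))
    lhsWord-∷ʳ []       y = ≈ᴹ-refl
    lhsWord-∷ʳ (y₀ ∷ w) y = ≈ᴹ-reflexive (foldl-map-∷ʳ (λ acc b → R (acc · b)) (R (a y₀)) w y)

    lhsArg : ∀ {n} → Vec X n → Carrierᴹ
    lhsArg S = ∑ (picks S) (λ (c , S′) → symMul lhsWord S′ (a c))

    symSum-lhsWord : ∀ {n} (S : Vec X (suc n)) → symSum lhsWord S ≈ᴹ R (lhsArg S)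
    symSum-lhsWord S = begin
      symSum lhsWord S
        ≈⟨ symSum-byLast lhsWord S ⟩
      ∑ (picks S) (λ (c , S′) → symSum (λ w → lhsWord (w ∷ʳ c)) S′)
        ≈⟨ ∑-cong (picks S) (λ (c , S′) → ≈ᴹ-trans (symSum-cong S′ (λ w → lhsWord-∷ʳ w c))
                                                    (≈ᴹ-sym (symSum-homo R-homo _ S′))) ⟩
      ∑ (picks S) (λ (c , S′) → R (symMul lhsWord S′ (a c)))
        ≈⟨ ∑-homo R-homo (picks S) _ ⟨
      R (lhsArg S) ∎

    lhsArg-·ʳ : ∀ {n} (S : Vec X n) W →
                lhsArg S · W ≈ᴹ ∑ (picks S) (λ (c , S′) → symMul lhsWord S′ (a c · W))
    lhsArg-·ʳ S W = ≈ᴹ-trans (∑-homo (·-homoʳ W) (picks S) _)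
                             (∑-cong (picks S) (λ (c , S′) → symMul-assoc lhsWord S′ (a c) W))

    symMul-R : ∀ {n} (S : Vec X n) Y →
               symMul lhsWord S (R Y) ≈ᴹ R (symMul lhsWord S Y +ᴹ lhsArg S · (R Y +ᴹ Y))
    symMul-R [] Y = R-cong (≈ᴹ-sym (≈ᴹ-trans (+ᴹ-congˡ (ε-homo (·-homoʳ _))) (+ᴹ-identityʳ Y)))
    symMul-R S@(_ ∷ _) Y = begin
      symMul lhsWord S (R Y)                     ≈⟨ symMul-∷ lhsWord S (R Y) ⟩
      symSum lhsWord S · R Y                     ≈⟨ ·-cong (symSum-lhsWord S) ≈ᴹ-refl ⟩
      R L · R Y                                  ≈⟨ R-RB L Y ⟩
      R (R L · Y +ᴹ L · R Y) +ᴹ R (L · Y)        ≈⟨ R-+ _ _ ⟨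
      R ((R L · Y +ᴹ L · R Y) +ᴹ L · Y)          ≈⟨ R-cong (+ᴹ-assoc _ _ _) ⟩
      R (R L · Y +ᴹ (L · R Y +ᴹ L · Y))
        ≈⟨ R-cong (+ᴹ-cong (·-cong (≈ᴹ-sym (symSum-lhsWord S)) ≈ᴹ-refl)
                           (≈ᴹ-sym (·-distribˡ L _ _))) ⟩
      R (symSum lhsWord S · Y +ᴹ L · (R Y +ᴹ Y)) ≈⟨ R-cong (+ᴹ-congʳ (symMul-∷ lhsWord S Y)) ⟨
      R (symMul lhsWord S Y +ᴹ L · (R Y +ᴹ Y))   ∎
      where L = lhsArg S

    bulletWord : X → List X → Carrierᴹ
    bulletWord z t = foldl _•R_ (a z) (map a t)

    bulletSum : ∀ {n} → X → Vec X n → Carrierᴹ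
    bulletSum z T = symSum (bulletWord z) T

    bulletSum-byLast : ∀ {n} z (T : Vec X n) →
                       bulletSum z T
                       ≈ᴹ ifEmpty T (a z) +ᴹ ∑ (picks T) (λ (c , T′) → bulletSum z T′ •R a c)
    bulletSum-byLast z []        = ≈ᴹ-sym (+ᴹ-identityʳ _)
    bulletSum-byLast z T@(_ ∷ _) = begin
      bulletSum z T
        ≈⟨ symSum-byLast (bulletWord z) T ⟩
      ∑ (picks T) (λ (c , T′) → symSum (λ t → bulletWord z (t ∷ʳ c)) T′)
        ≈⟨ ∑-cong (picks T) (λ (c , T′) →
             ≈ᴹ-trans (symSum-cong T′ (λ t → ≈ᴹ-reflexive (foldl-map-∷ʳ _•R_ (a z) t c)))
                      (≈ᴹ-sym (symSum-homo (•R-homo (a c)) (bulletWord z) T′))) ⟩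
      ∑ (picks T) (λ (c , T′) → bulletSum z T′ •R a c)
        ≈⟨ +ᴹ-identityˡ _ ⟨
      0ᴹ +ᴹ ∑ (picks T) (λ (c , T′) → bulletSum z T′ •R a c) ∎

    symMul-bulletSum : ∀ {i j} z (S : Vec X i) (T : Vec X j) →
      symMul lhsWord S (bulletSum z T) ≈ᴹ symMul lhsWord S (ifEmpty T (a z)) +ᴹ
        ∑ (picks T) (λ (c , T′) → symMul lhsWord S (R (bulletSum z T′) · a c)
                                   +ᴹ -ᴹ symMul lhsWord S (a c · (R (bulletSum z T′) +ᴹ bulletSum z T′)))
    symMul-bulletSum z S T = begin
      _ ≈⟨ ⟦⟧-cong S-homo (bulletSum-byLast z T) ⟩
      _ ≈⟨ homo S-homo _ _ ⟩
      _ ≈⟨ +ᴹ-congˡ (∑-homo S-homo (picks T) _) ⟩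
      _ ≈⟨ +ᴹ-congˡ (∑-cong (picks T) (λ (c , T′) →
             ≈ᴹ-trans (⟦⟧-cong S-homo (•R-expand _ _))
                      (≈ᴹ-trans (homo S-homo _ _) (+ᴹ-congˡ (-ᴹ-homo S-homo _))))) ⟩
      _ ∎
      where S-homo = symMul-homo lhsWord S

    module _ (z : X) where

      Y : ∀ {n} → Vec X n → Carrierᴹ
      Y T = R (bulletSum z T) +ᴹ bulletSum z T

      P Q : ∀ {n} → Vec X n → Carrierᴹ
      P U = ∑ (picks U) (λ (c , U′) →
              ∑ (splits U′) (λ (S ∣ T) → symMul lhsWord S (R (bulletSum z T) · a c)))
      Q U = ∑ (picks U) (λ (c , U′) → ∑ (splits U′) (λ (S ∣ T) → symMul lhsWord S (a c · Y T)))

      ∑-splits-bulletSum : ∀ {n} (U : Vec X n) →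
        ∑ (splits U) (λ (S ∣ T) → symMul lhsWord S (bulletSum z T))
        ≈ᴹ symMul lhsWord U (a z) +ᴹ (P U +ᴹ -ᴹ Q U)
      ∑-splits-bulletSum U = begin
        _ ≈⟨ ∑-cong (splits U) (λ (S ∣ T) → symMul-bulletSum z S T) ⟩
        _ ≈⟨ ∑-distrib-∙ (splits U) _ _ ⟩
        _ ≈⟨ +ᴹ-cong (∑-splits-[]ʳ (λ S T → symMul lhsWord S (ifEmpty T (a z)))
                                   (λ S _ _ → ε-homo (symMul-homo lhsWord S)) U)
                     (≈ᴹ-trans (∑-cong (splits U) (λ (S ∣ T) → ∑-difference (picks T) _ _))
                               (∑-difference (splits U) _ _)) ⟩
        _ ≈⟨ +ᴹ-congˡ (+ᴹ-cong
               (∑-splits-picksʳ (λ S c T → symMul lhsWord S (R (bulletSum z T) · a c)) U)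
               (-ᴹ‿cong (∑-splits-picksʳ (λ S c T → symMul lhsWord S (a c · Y T)) U))) ⟩
        _ ∎

      ∑-splits-lhsArg : ∀ {n} (U : Vec X n) → ∑ (splits U) (λ (S ∣ T) → lhsArg S · Y T) ≈ᴹ Q U
      ∑-splits-lhsArg U = ≈ᴹ-trans (∑-cong (splits U) (λ (S ∣ T) → lhsArg-·ʳ S (Y T)))
                                   (∑-splits-picksˡ (λ S c T → symMul lhsWord S (a c · Y T)) U)

    symSum-lhsWord-∷ : ∀ {n} z (U : Vec X n) →
      symSum lhsWord (z ∷ U) ≈ᴹ ∑ (splits U) (λ (S ∣ T) → symMul lhsWord S (R (bulletSum z T)))
    symSum-lhsWord-∷ {zero}  z [] = ≈ᴹ-refl
    symSum-lhsWord-∷ {suc n} z U  = begin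
      symSum lhsWord (z ∷ U)
        ≈⟨ symSum-lhsWord (z ∷ U) ⟩
      R (lhsArg (z ∷ U))
        ≈⟨ R-cong lhsArg-∷ ⟩
      R (symMul lhsWord U (a z) +ᴹ P z U)
        ≈⟨ R-cong (+ᴹ-congˡ (cancel (P z U) (Q z U))) ⟨
      R (symMul lhsWord U (a z) +ᴹ ((P z U +ᴹ -ᴹ Q z U) +ᴹ Q z U))
        ≈⟨ R-cong (+ᴹ-assoc _ _ _) ⟨
      R ((symMul lhsWord U (a z) +ᴹ (P z U +ᴹ -ᴹ Q z U)) +ᴹ Q z U)
        ≈⟨ R-cong (+ᴹ-cong (∑-splits-bulletSum z U) (∑-splits-lhsArg z U)) ⟨
      R (∑ (splits U) (λ (S ∣ T) → symMul lhsWord S (bulletSum z T))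
         +ᴹ ∑ (splits U) (λ (S ∣ T) → lhsArg S · Y z T))
        ≈⟨ R-cong (∑-distrib-∙ (splits U) _ _) ⟨
      R (∑ (splits U) (λ (S ∣ T) → symMul lhsWord S (bulletSum z T) +ᴹ lhsArg S · Y z T))
        ≈⟨ ∑-homo R-homo (splits U) _ ⟩
      ∑ (splits U) (λ (S ∣ T) → R (symMul lhsWord S (bulletSum z T) +ᴹ lhsArg S · Y z T))
        ≈⟨ ∑-cong (splits U) (λ (S ∣ T) → symMul-R S (bulletSum z T)) ⟨
      ∑ (splits U) (λ (S ∣ T) → symMul lhsWord S (R (bulletSum z T))) ∎
      where
      cancel : ∀ v w → (v +ᴹ -ᴹ w) +ᴹ w ≈ᴹ v
      cancel v w =
        ≈ᴹ-trans (+ᴹ-assoc _ _ _) (≈ᴹ-trans (+ᴹ-congˡ (-ᴹ‿inverseˡ w)) (+ᴹ-identityʳ v))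

      lhsArg-∷ : lhsArg (z ∷ U) ≈ᴹ symMul lhsWord U (a z) +ᴹ P z U
      lhsArg-∷ = ≈ᴹ-trans (∑-picks-∷ (λ c S′ → symMul lhsWord S′ (a c)) z U)
                          (+ᴹ-congˡ (∑-cong (picks U) λ (c , U′) → begin
        symMul lhsWord (z ∷ U′) (a c)
          ≈⟨ symMul-∷ lhsWord (z ∷ U′) (a c) ⟩
        symSum lhsWord (z ∷ U′) · a c
          ≈⟨ ·-cong (symSum-lhsWord-∷ {n} z U′) ≈ᴹ-refl ⟩
        ∑ (splits U′) (λ (S ∣ T) → symMul lhsWord S (R (bulletSum z T))) · a c
          ≈⟨ ∑-homo (·-homoʳ (a c)) (splits U′) _ ⟩
        ∑ (splits U′) (λ (S ∣ T) → symMul lhsWord S (R (bulletSum z T)) · a c)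
          ≈⟨ ∑-cong (splits U′) (λ (S ∣ T) → symMul-assoc lhsWord S _ _) ⟩
        ∑ (splits U′) (λ (S ∣ T) → symMul lhsWord S (R (bulletSum z T) · a c)) ∎))

  module RightHandSide {N : ℕ} (a : Fin N → Carrierᴹ) where
    open Selections (Fin N)
    open SymmetricSums +ᴹ-commutativeMonoid (Fin N)
    open Words a

    rhsWord : List (Fin N) → Carrierᴹ
    rhsWord []      = 0ᴹ
    rhsWord (y ∷ w) = R (evalWord nothing (a y) (opsWord a (toℕ y) w))

    bullets : List (Fin N) → List (Op × Carrierᴹ)
    bullets = map (λ v → bullet , a v)

    opsWord-below : ∀ M t → All (λ v → toℕ v ℕ.< M) t → opsWord a M t ≡ bullets t
    opsWord-below M []      All.[]                  = ≡.refl
    opsWord-below M (v ∷ t) (v<M All.∷ t<M)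
      rewrite <ᵇ-false (<⇒≤ v<M) | m≥n⇒m⊔n≡m (<⇒≤ v<M) = ≡.cong (_ ∷_) (opsWord-below M t t<M)

    opsWord-insertMax : ∀ M s z t → M ℕ.< toℕ z → All (Fin._< z) s → All (Fin._< z) t →
                        opsWord a M (s ++ z ∷ t) ≡ opsWord a M s ++ (star , a z) ∷ bullets t
    opsWord-insertMax M []      z t M<z _                 t<z
      rewrite <ᵇ-true M<z | m≤n⇒m⊔n≡n (<⇒≤ M<z) = ≡.cong (_ ∷_) (opsWord-below (toℕ z) t t<z)
    opsWord-insertMax M (v ∷ s) z t M<z (v<z All.∷ s<z) t<z =
      ≡.cong (_ ∷_) (opsWord-insertMax (M ℕ.⊔ toℕ v) s z t (⊔-lub M<z v<z) s<z t<z)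

    evalWord-++-star : ∀ acc cur w y w′ →
                       evalWord acc cur (w ++ (star , y) ∷ w′) ≡ evalWord (just (evalWord acc cur w)) y w′
    evalWord-++-star acc cur []                 y w′ = ≡.refl
    evalWord-++-star acc cur ((bullet , v) ∷ w) y w′ = evalWord-++-star acc (cur •R v) w y w′
    evalWord-++-star acc cur ((star   , v) ∷ w) y w′ = evalWord-++-star (just (close acc cur)) v w y w′

    evalWord-bullets : ∀ acc cur t → evalWord acc cur (bullets t) ≡ close acc (foldl _•R_ cur (map a t))
    evalWord-bullets acc cur []      = ≡.refl
    evalWord-bullets acc cur (v ∷ t) = evalWord-bullets acc (cur •R a v) t

    -- z exceeds the running maximum of s and every letter of t, so it opens a new ∗-block
    -- to which all of t is attached by •.
    rhsWord-insertMax : ∀ z s t → All (Fin._< z) s → All (Fin._< z) t →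
                        rhsWord (s ++ z ∷ t) ≈ᴹ mulWord rhsWord s (R (bulletWord z t))
    rhsWord-insertMax z []      t _ t<z = ≈ᴹ-reflexive (≡.cong R (≡.trans
      (≡.cong (evalWord nothing (a z)) (opsWord-below (toℕ z) t t<z)) (evalWord-bullets nothing (a z) t)))
    rhsWord-insertMax z (y ∷ s) t (y<z All.∷ s<z) t<z = begin
      R (evalWord nothing (a y) (opsWord a (toℕ y) (s ++ z ∷ t)))
        ≡⟨ ≡.cong (R ∘ evalWord nothing (a y)) (opsWord-insertMax (toℕ y) s z t y<z s<z t<z) ⟩
      R (evalWord nothing (a y) (opsWord a (toℕ y) s ++ (star , a z) ∷ bullets t))
        ≡⟨ ≡.cong R (≡.trans (evalWord-++-star nothing (a y) (opsWord a (toℕ y) s) (a z) (bullets t))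
                             (evalWord-bullets (just _) (a z) t)) ⟩
      R (evalWord nothing (a y) (opsWord a (toℕ y) s) ∗R bulletWord z t)
        ≈⟨ R-∗R _ _ ⟩
      rhsWord (y ∷ s) · R (bulletWord z t) ∎

    symSum-lhsWord≈rhsWord-∷ : ∀ {n} →
      (∀ {i} (S : Vec (Fin N) i) → i ≤ n → AllPairs Fin._<_ S → symSum lhsWord S ≈ᴹ symSum rhsWord S) →
      ∀ z (U : Vec (Fin N) n) → VecAll.All (Fin._< z) U → AllPairs Fin._<_ U →
      symSum lhsWord (z ∷ U) ≈ᴹ symSum rhsWord (z ∷ U)
    symSum-lhsWord≈rhsWord-∷ {n} ih z U U<z sortedU = begin
      symSum lhsWord (z ∷ U)
        ≈⟨ symSum-lhsWord-∷ z U ⟩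
      ∑ (splits U) (λ (S ∣ T) → symMul lhsWord S (R (bulletSum z T)))
        ≈⟨ ∑-cong-All (All.zip (splits-length U , All.zip (splits-AllPairs sortedU , splits-All U<z)))
                      (λ {(S ∣ T)} (i≤n , sortedS , S<z , T<z) → split≈ S T i≤n sortedS S<z T<z) ⟩
      ∑ (splits U) (λ (S ∣ T) → symSum (λ s → symSum (λ t → rhsWord (s ++ z ∷ t)) T) S)
        ≈⟨ symSum-insert rhsWord z U ⟨
      symSum rhsWord (z ∷ U) ∎
      where
      split≈ : ∀ {i j} (S : Vec (Fin N) i) (T : Vec (Fin N) j) → i ≤ n → AllPairs Fin._<_ S →
               VecAll.All (Fin._< z) S → VecAll.All (Fin._< z) T →
               symMul lhsWord S (R (bulletSum z T))
               ≈ᴹ symSum (λ s → symSum (λ t → rhsWord (s ++ z ∷ t)) T) S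
      split≈ S T i≤n sortedS S<z T<z = begin
        symMul lhsWord S (R (bulletSum z T))
          ≈⟨ symSum≈⇒symMul≈ S _ (ih S i≤n sortedS) ⟩
        symMul rhsWord S (R (bulletSum z T))
          ≈⟨ symSum-cong S (λ s →
               ⟦⟧-cong (mulWord-homo rhsWord s) (symSum-homo R-homo (bulletWord z) T)) ⟩
        symSum (λ s → mulWord rhsWord s (symSum (R ∘ bulletWord z) T)) S
          ≈⟨ symSum-cong S (λ s → symSum-homo (mulWord-homo rhsWord s) _ T) ⟩
        symSum (λ s → symSum (λ t → mulWord rhsWord s (R (bulletWord z t))) T) S
          ≈⟨ symSum-cong-All S S<z (λ s s<z →
               symSum-cong-All T T<z (λ t t<z → rhsWord-insertMax z s t s<z t<z)) ⟨
        symSum (λ s → symSum (λ t → rhsWord (s ++ z ∷ t)) T) S ∎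

    symSum-lhsWord≈rhsWord : ∀ {n} (V : Vec (Fin N) n) → AllPairs Fin._<_ V →
                             symSum lhsWord V ≈ᴹ symSum rhsWord V
    symSum-lhsWord≈rhsWord {n} = <-rec Claim step n
      where
      Claim : ℕ → Set _
      Claim n = ∀ (V : Vec (Fin N) n) → AllPairs Fin._<_ V → symSum lhsWord V ≈ᴹ symSum rhsWord V

      step : ∀ n → (∀ {i} → i ℕ.< n → Claim i) → Claim n
      step zero    _  [] _ = ≈ᴹ-refl
      step (suc n) ih V sorted with Vec.initLast V
      ... | U , z , ≡.refl with AllPairs-∷ʳ⁻ U z sorted
      ... | U<z , sortedU = begin
        symSum lhsWord (U Vec.∷ʳ z) ≈⟨ symSum-∷ʳ lhsWord U z ⟩
        symSum lhsWord (z ∷ U)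
          ≈⟨ symSum-lhsWord≈rhsWord-∷ (λ S i≤n → ih (s≤s i≤n) S) z U U<z sortedU ⟩
        symSum rhsWord (z ∷ U)      ≈⟨ symSum-∷ʳ rhsWord U z ⟨
        symSum rhsWord (U Vec.∷ʳ z) ∎

module SidesAsSymmetricSums {c ℓ m ℓm} {K : CommutativeRing c ℓ} (A : RBAlgebra K m ℓm)
                            (k : ℕ) (a : Fin (suc k) → RBAlgebra.Carrierᴹ A) where
  open RBAlgebra A
  open Module vectorSpace using (+ᴹ-commutativeMonoid; ≈ᴹ-trans; ≈ᴹ-reflexive)
  open FiniteSums +ᴹ-commutativeMonoid
  open SymmetricSums +ᴹ-commutativeMonoid (Fin (suc k)) public
  open RotaBaxterWords A
  open Words a public
  open RightHandSide a public
  open Sides A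

  LHS≈symSum-lhsWord : LHS k a ≈ᴹ symSum lhsWord (Vec.tabulate id)
  LHS≈symSum-lhsWord = ≈ᴹ-trans
    (∑-cong (permutations (suc k)) (λ σ → ≈ᴹ-reflexive (≡.cong (lhsTerm (a (σ fzero)))
      (≡.trans (List.map-tabulate id _) (≡.sym (List.map-tabulate (σ ∘ fsuc) a))))))
    (∑-permutations id lhsWord)

  RHS≈symSum-rhsWord : RHS k a ≈ᴹ symSum rhsWord (Vec.tabulate id)
  RHS≈symSum-rhsWord = ≈ᴹ-trans
    (∑-cong (permutations (suc k)) (λ σ → ≈ᴹ-reflexive
      (≡.cong (R ∘ evalWord nothing (a (σ fzero)) ∘ opsWord a (toℕ (σ fzero)))
              (List.map-tabulate id (σ ∘ fsuc)))))
    (∑-permutations id rhsWord)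

mainTheorem11 : ∀ {c ℓ m ℓm : Level} (K : CommutativeRing c ℓ) → IsFieldCharZero K →
    (A : RBAlgebra K m ℓm) → (k : ℕ) → (a : Fin (suc k) → RBAlgebra.Carrierᴹ A) →
    RBAlgebra._≈ᴹ_ A (Sides.LHS A k a) (Sides.RHS A k a)
mainTheorem11 K _ A k a = begin
  LHS k a                          ≈⟨ LHS≈symSum-lhsWord ⟩
  symSum lhsWord (Vec.tabulate id) ≈⟨ symSum-lhsWord≈rhsWord (Vec.tabulate id) (AllPairs-tabulate id) ⟩
  symSum rhsWord (Vec.tabulate id) ≈⟨ RHS≈symSum-rhsWord ⟨
  RHS k a                          ∎
  where
  open SidesAsSymmetricSums A k a
  open Sides A using (LHS; RHS)
  open Module (RBAlgebra.vectorSpace A) using (≈ᴹ-setoid)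
  open import Relation.Binary.Reasoning.Setoid ≈ᴹ-setoid
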